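{- Let $K$ be a field and let $A=(\mathbf{a}_1,\ldots,\mathbf{a}_m)$ be a configuration (an $n\times m$ integer matrix with columns $\mathbf{a}_1,\ldots,\mathbf{a}_m$). Suppose that $r\ge 3$ and that indices $i_1,\ldots,i_r,j_1,\ldots,j_r\in\{1,\ldots,m\}$ satisfy $$\mathbf{a}_{i_1}+\cdots+\mathbf{a}_{i_r}=\mathbf{a}_{j_1}+\cdots+\mathbf{a}_{j_r},\qquad \{i_1,\ldots,i_r\}\cap\{j_1,\ldots,j_r\}=\emptyset .$$ Suppose moreover that for all $1\le k<\ell\le r$ and all $1\le p,q\le m$, $$\mathbf{a}_{i_k}+\mathbf{a}_{i_\ell}=\mathbf{a}_p+\mathbf{a}_q \iff \{i_k,i_\ell\}=\{p,q\}.$$ Then the toric ideal $I_A$ is not generated by quadratic binomials.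
   Context: An $n\times m$ integer matrix $A=(\mathbf{a}_1,\ldots,\mathbf{a}_m)$ is a configuration if there exists $\mathbf{c}\in\mathbb{R}^n$ with $\mathbf{a}_j\cdot\mathbf{c}=1$ for all $1\le j\le m$. Its toric ideal is the ideal $$I_A=\Big\langle \prod_{b_i>0}y_i^{b_i}-\prod_{b_j<0}y_j^{ -b_j} \;:\; \mathbf{b}=(b_1,\ldots,b_m)^T\in\mathbb{Z}^m,\ A\mathbf{b}=\mathbf{0}\Big\rangle\subset K[y_1,\ldots,y_m].$$ "Generated by quadratic binomials" means $I_A$ is generated by binomials of degree $2$. -}

module Defs where

open import Level using (Level; _⊔_) renaming (suc to lsuc)
open import Data.Nat as ℕ using (ℕ; zero; suc)
open import Data.Fin using (Fin; zero; suc)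
open import Data.Integer as ℤ using (ℤ; +_; -[1+_])
open import Data.Rational as ℚ using (ℚ)
open import Data.Vec using (Vec; tabulate; zipWith)
open import Data.Vec.Properties using (≡-dec)
open import Data.List using (List; []; _∷_; _++_; concatMap; map)
open import Data.List.Relation.Unary.All using (All)
open import Data.Product using (Σ; _×_; _,_; proj₁; proj₂)
open import Data.Sum using (_⊎_)
open import Relation.Nullary using (¬_; yes; no)
open import Relation.Binary.PropositionalEquality using (_≡_)
open import Algebra.Bundles using (CommutativeRing)

record Field (c ℓ : Level) : Set (lsuc (c ⊔ ℓ)) where
  field
    commutativeRing : CommutativeRing c ℓ
  open CommutativeRing commutativeRing public
  field
    1≉0     : ¬ (1# ≈ 0#)
    inverse : ∀ x → ¬ (x ≈ 0#) → Σ Carrier λ y → (x * y) ≈ 1#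

Σℤ : (k : ℕ) → (Fin k → ℤ) → ℤ
Σℤ zero    f = + 0
Σℤ (suc k) f = f zero ℤ.+ Σℤ k (λ i → f (suc i))

Σℚ : (k : ℕ) → (Fin k → ℚ) → ℚ
Σℚ zero    f = ℚ.0ℚ
Σℚ (suc k) f = f zero ℚ.+ Σℚ k (λ i → f (suc i))

Σℕ : (k : ℕ) → (Fin k → ℕ) → ℕ
Σℕ zero    f = 0
Σℕ (suc k) f = f zero ℕ.+ Σℕ k (λ i → f (suc i))

-- Integer matrices (n rows, m columns), columns a_j = λ t → A t j.

Matrix : ℕ → ℕ → Set
Matrix n m = Fin n → Fin m → ℤ

IsConfiguration : ∀ {n m} → Matrix n m → Set
IsConfiguration {n} {m} A =
  Σ (Fin n → ℚ) λ c → ∀ (j : Fin m) → Σℚ n (λ t → (A t j ℚ./ 1) ℚ.* c t) ≡ ℚ.1ℚ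

InKernel : ∀ {n m} → Matrix n m → (Fin m → ℤ) → Set
InKernel {n} {m} A b = ∀ (t : Fin n) → Σℤ m (λ j → A t j ℤ.* b j) ≡ + 0

pos : ℤ → ℕ
pos (+ k)    = k
pos -[1+ k ] = 0

neg : ℤ → ℕ
neg (+ k)    = 0
neg -[1+ k ] = suc k

-- Polynomials in y_1..y_m over a field K, as formal finite sums of terms
-- (coefficient, exponent vector). Equality is coefficientwise.

module Poly {c ℓ : Level} (K : Field c ℓ) (m : ℕ) where
  open Field K

  Monomial : Set
  Monomial = Vec ℕ m

  Pol : Set c
  Pol = List (Carrier × Monomial)

  mono : (Fin m → ℕ) → Monomial
  mono u = tabulate u

  deg : (Fin m → ℕ) → ℕ
  deg u = Σℕ m u

  coeff : Pol → Monomial → Carrier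
  coeff []             u = 0#
  coeff ((a , v) ∷ f) u with ≡-dec ℕ._≟_ v u
  ... | yes _ = a + coeff f u
  ... | no  _ = coeff f u

  _≈ₚ_ : Pol → Pol → Set ℓ
  f ≈ₚ g = ∀ u → coeff f u ≈ coeff g u

  _+ₚ_ : Pol → Pol → Pol
  f +ₚ g = f ++ g

  addMono : Monomial → Monomial → Monomial
  addMono u v = zipWith ℕ._+_ u v

  _*ₚ_ : Pol → Pol → Pol
  f *ₚ g = concatMap (λ { (a , u) → map (λ { (b , v) → (a * b , addMono u v) }) g }) f

  0ₚ : Pol
  0ₚ = []

  binomial : (Fin m → ℕ) → (Fin m → ℕ) → Pol
  binomial u v = (1# , mono u) ∷ (- 1# , mono v) ∷ []

  combination : List (Pol × Pol) → Pol
  combination []             = 0ₚ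
  combination ((h , g) ∷ L) = (h *ₚ g) +ₚ combination L

  InIdeal : ∀ {ℓ'} → (Pol → Set ℓ') → Pol → Set (c ⊔ ℓ ⊔ ℓ')
  InIdeal G f = Σ (List (Pol × Pol)) λ L →
    All (λ hg → G (proj₂ hg)) L × (f ≈ₚ combination L)

  ToricGenerator : ∀ {n} → Matrix n m → Pol → Set c
  ToricGenerator A g = Σ (Fin m → ℤ) λ b →
    InKernel A b × (g ≡ binomial (λ j → pos (b j)) (λ j → neg (b j)))

  InToricIdeal : ∀ {n} → Matrix n m → Pol → Set (c ⊔ ℓ)
  InToricIdeal A = InIdeal (ToricGenerator A)

  IsQuadraticBinomial : Pol → Set ℓ
  IsQuadraticBinomial g = Σ (Fin m → ℕ) λ u → Σ (Fin m → ℕ) λ v →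
    deg u ≡ 2 × deg v ≡ 2 × g ≈ₚ binomial u v

  GeneratedByQuadraticBinomials : ∀ {n} → Matrix n m → Set (lsuc (c ⊔ ℓ))
  GeneratedByQuadraticBinomials A =
    Σ (Pol → Set (c ⊔ ℓ)) λ G →
      (∀ g → G g → IsQuadraticBinomial g) ×
      (∀ f → (InToricIdeal A f → InIdeal G f) × (InIdeal G f → InToricIdeal A f))

-- Let b be the exponent vector of y_{i₁}⋯y_{i_r} / y_{j₁}⋯y_{j_r}, so y^{b⁺} − y^{b⁻} lies in I_A.
-- Pair polynomials with functions F on monomials via f ↦ Σ a·F(w) over the terms a·y^w of f.
-- The indicator of an A-fibre kills I_A, hence every binomial y^u − y^v in I_A has A u = A v.
-- The indicator of the single monomial y^{b⁺}, i.e. the coefficient of y^{b⁺}, kills every multiple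
-- y^w (y^u − y^v) of such a quadratic binomial: if y^{w+u} = y^{b⁺} then y^u = y_{i_k} y_{i_l} with
-- k ≠ l, so y^v = y^u by hypothesis. So this coefficient vanishes on the ideal generated by any set
-- of quadratic binomials of I_A, whereas it is 1 on y^{b⁺} − y^{b⁻}.

module Submission where

open import Defs
open import Level using (Level)
open import Data.Nat using (ℕ; _≥_)
open import Data.Fin using (Fin; _<_)
open import Data.Integer using (_+_)
open import Data.Product using (_×_)
open import Data.Sum using (_⊎_)
open import Relation.Nullary using (¬_)
open import Relation.Binary.PropositionalEquality using (_≡_; _≢_)

open import Algebra.Properties.CommutativeSemigroup using (interchange)
import Algebra.Properties.Ring as RingProperties
open import Data.Bool using (if_then_else_)
open import Data.Empty using (⊥-elim)
open import Data.Fin using (zero; suc)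
open import Data.Fin.Properties as Finₚ using (<-cmp; all?)
open import Data.Integer as ℤ using (ℤ; +_; -[1+_])
import Data.Integer.Properties as ℤₚ
open import Data.List using (List; []; _∷_; _++_; map; deduplicate)
open import Data.List.Membership.Propositional using (_∈_)
open import Data.List.Membership.Propositional.Properties using (∈-map⁺; ∈-deduplicate⁺)
open import Data.List.Relation.Unary.All as All using (All; []; _∷_)
import Data.List.Relation.Unary.All.Properties as Allₚ
open import Data.List.Relation.Unary.Any using (here; there)
open import Data.List.Relation.Unary.Unique.Propositional using (Unique; []; _∷_)
open import Data.List.Relation.Unary.Unique.DecPropositional.Properties using (deduplicate-!)
import Data.Nat as ℕ
open import Data.Nat using (zero; suc; _≤_; z≤n; s≤s)
import Data.Nat.Properties as ℕₚ
open import Data.Product using (Σ; ∃₂; _,_; proj₁; proj₂)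
open import Data.Sum using (inj₁; inj₂)
open import Data.Vec using (lookup; replicate)
open import Data.Vec.Properties
  using (≡-dec; lookup∘tabulate; lookup-zipWith; tabulate-cong; zipWith-identityˡ)
open import Function using (_∘_; _⇔_; Equivalence; mk⇔)
open import Relation.Binary using (DecidableEquality; tri<; tri≈; tri>)
open import Relation.Binary.PropositionalEquality
  using (refl; sym; trans; cong; cong₂; subst; subst₂; _≗_; module ≡-Reasoning)
open import Relation.Nullary using (yes; no; does)
open import Relation.Nullary.Decidable using (dec-true; dec-false)
open import Relation.Unary using (Pred; Decidable)
import Relation.Binary.Reasoning.Setoid as SetoidReasoning

Σℤ-cong : ∀ k {f g : Fin k → ℤ} → f ≗ g → Σℤ k f ≡ Σℤ k g
Σℤ-cong zero    f≗g = refl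
Σℤ-cong (suc k) f≗g = cong₂ _+_ (f≗g zero) (Σℤ-cong k (f≗g ∘ suc))

Σℤ-distrib-+ : ∀ k (f g : Fin k → ℤ) → Σℤ k (λ x → f x + g x) ≡ Σℤ k f + Σℤ k g
Σℤ-distrib-+ zero    f g = refl
Σℤ-distrib-+ (suc k) f g =
  trans (cong (λ s → f zero + g zero + s) (Σℤ-distrib-+ k (f ∘ suc) (g ∘ suc)))
        (interchange ℤₚ.+-commutativeSemigroup (f zero) (g zero) _ _)

Σℤ-neg : ∀ k (f : Fin k → ℤ) → Σℤ k (λ x → ℤ.- f x) ≡ ℤ.- Σℤ k f
Σℤ-neg zero    f = refl
Σℤ-neg (suc k) f =
  trans (cong (λ s → ℤ.- f zero + s) (Σℤ-neg k (f ∘ suc))) (sym (ℤₚ.neg-distrib-+ (f zero) _))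

Σℤ-zero : ∀ k → Σℤ k (λ _ → + 0) ≡ + 0
Σℤ-zero zero    = refl
Σℤ-zero (suc k) = trans (ℤₚ.+-identityˡ _) (Σℤ-zero k)

δ : ∀ {m} → Fin m → Fin m → ℕ
δ zero    zero    = 1
δ zero    (suc _) = 0
δ (suc _) zero    = 0
δ (suc p) (suc q) = δ p q

δ-refl : ∀ {m} (p : Fin m) → δ p p ≡ 1
δ-refl zero    = refl
δ-refl (suc p) = δ-refl p

δ-≢ : ∀ {m} {p q : Fin m} → p ≢ q → δ p q ≡ 0
δ-≢ {p = zero}  {zero}  p≢q = ⊥-elim (p≢q refl)
δ-≢ {p = zero}  {suc q} p≢q = refl
δ-≢ {p = suc p} {zero}  p≢q = refl
δ-≢ {p = suc p} {suc q} p≢q = δ-≢ (p≢q ∘ cong suc)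

Σℤ-*-δ : ∀ m (f : Fin m → ℤ) p → Σℤ m (λ j → f j ℤ.* + δ p j) ≡ f p
Σℤ-*-δ (suc m) f zero = begin
  f zero ℤ.* + 1 + Σℤ m (λ j → f (suc j) ℤ.* + 0) ≡⟨ cong₂ _+_ (ℤₚ.*-identityʳ (f zero))
                                                      (Σℤ-cong m (ℤₚ.*-zeroʳ ∘ f ∘ suc)) ⟩
  f zero + Σℤ m (λ _ → + 0)                         ≡⟨ cong (_+_ (f zero)) (Σℤ-zero m) ⟩
  f zero + + 0                                      ≡⟨ ℤₚ.+-identityʳ (f zero) ⟩
  f zero                                            ∎
  where open ≡-Reasoning
Σℤ-*-δ (suc m) f (suc p) =
  trans (cong₂ _+_ (ℤₚ.*-zeroʳ (f zero)) (Σℤ-*-δ m (f ∘ suc) p)) (ℤₚ.+-identityˡ _)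

count : ∀ {r m} → (Fin r → Fin m) → Fin m → ℕ
count {r} f x = Σℕ r (λ k → δ (f k) x)

count-∉ : ∀ {r m} (f : Fin r → Fin m) x → (∀ k → f k ≢ x) → count f x ≡ 0
count-∉ {zero}  f x ∉ = refl
count-∉ {suc r} f x ∉ = cong₂ ℕ._+_ (δ-≢ (∉ zero)) (count-∉ (f ∘ suc) x (∉ ∘ suc))

count-≥1 : ∀ {r m} (f : Fin r → Fin m) x → 1 ≤ count f x → Σ (Fin r) λ k → f k ≡ x
count-≥1 {suc r} f x c≥1 with f zero Finₚ.≟ x
... | yes f0≡x = zero , f0≡x
... | no  f0≢x rewrite δ-≢ f0≢x = let (k , fk≡x) = count-≥1 (f ∘ suc) x c≥1 in suc k , fk≡x

count-≥2 : ∀ {r m} (f : Fin r → Fin m) x → 2 ≤ count f x →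
           ∃₂ λ k l → k ≢ l × f k ≡ x × f l ≡ x
count-≥2 {suc r} f x c≥2 with f zero Finₚ.≟ x
... | yes refl rewrite δ-refl (f zero) =
  let (l , fl≡x) = count-≥1 (f ∘ suc) x (ℕₚ.≤-pred c≥2) in zero , suc l , (λ ()) , refl , fl≡x
... | no  f0≢x rewrite δ-≢ f0≢x =
  let (k , l , k≢l , fk≡x , fl≡x) = count-≥2 (f ∘ suc) x c≥2
  in suc k , suc l , k≢l ∘ Finₚ.suc-injective , fk≡x , fl≡x

count-∈ : ∀ {r m} (f : Fin r → Fin m) k → 1 ≤ count f (f k)
count-∈ f zero rewrite δ-refl (f zero) = s≤s z≤n
count-∈ f (suc k) = ℕₚ.≤-trans (count-∈ (f ∘ suc) k) (ℕₚ.m≤n+m _ (δ (f zero) (f (suc k))))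

δ+δ≤count⇒pair : ∀ {r m} (f : Fin r → Fin m) p q → (∀ x → δ p x ℕ.+ δ q x ≤ count f x) →
                 ∃₂ λ k l → k ≢ l × f k ≡ p × f l ≡ q
δ+δ≤count⇒pair f p q bound with p Finₚ.≟ q
... | yes refl = count-≥2 f p (subst (λ d → d ℕ.+ d ≤ count f p) (δ-refl p) (bound p))
... | no  p≢q  =
  let (k , fk≡p) = count-≥1 f p (ℕₚ.≤-trans (1≤δ+ p q) (bound p))
      (l , fl≡q) = count-≥1 f q (ℕₚ.≤-trans (1≤+δ p q) (bound q))
  in k , l , (λ k≡l → p≢q (trans (sym fk≡p) (trans (cong f k≡l) fl≡q))) , fk≡p , fl≡q
  where
  1≤δ+ : ∀ p q → 1 ≤ δ p p ℕ.+ δ q p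
  1≤δ+ p q rewrite δ-refl p = s≤s z≤n
  1≤+δ : ∀ p q → 1 ≤ δ p q ℕ.+ δ q q
  1≤+δ p q rewrite δ-refl q = ℕₚ.m≤n+m 1 (δ p q)

Σℕ≡0⇒≗0 : ∀ m (u : Fin m → ℕ) → Σℕ m u ≡ 0 → ∀ x → u x ≡ 0
Σℕ≡0⇒≗0 (suc m) u Σu≡0 zero    = ℕₚ.m+n≡0⇒m≡0 (u zero) Σu≡0
Σℕ≡0⇒≗0 (suc m) u Σu≡0 (suc x) = Σℕ≡0⇒≗0 m (u ∘ suc) (ℕₚ.m+n≡0⇒n≡0 (u zero) Σu≡0) x

Σℕ≡1⇒δ : ∀ m (u : Fin m → ℕ) → Σℕ m u ≡ 1 → Σ (Fin m) λ p → ∀ x → u x ≡ δ p x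
Σℕ≡1⇒δ (suc m) u Σu≡1 with u zero in u₀
... | zero = let (p , u≗δ) = Σℕ≡1⇒δ m (u ∘ suc) Σu≡1 in
  suc p , λ { zero → u₀ ; (suc x) → u≗δ x }
... | suc zero = zero , λ { zero → u₀ ; (suc x) → Σℕ≡0⇒≗0 m (u ∘ suc) (ℕₚ.suc-injective Σu≡1) x }

Σℕ≡2⇒δ+δ : ∀ m (u : Fin m → ℕ) → Σℕ m u ≡ 2 → ∃₂ λ p q → ∀ x → u x ≡ δ p x ℕ.+ δ q x
Σℕ≡2⇒δ+δ (suc m) u Σu≡2 with u zero in u₀
... | zero = let (p , q , u≗δ+δ) = Σℕ≡2⇒δ+δ m (u ∘ suc) Σu≡2 in
  suc p , suc q , λ { zero → u₀ ; (suc x) → u≗δ+δ x }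
... | suc zero = let (q , u≗δ) = Σℕ≡1⇒δ m (u ∘ suc) (ℕₚ.suc-injective Σu≡2) in
  zero , suc q , λ { zero → u₀ ; (suc x) → u≗δ x }
... | suc (suc zero) = zero , zero , λ
  { zero → u₀ ; (suc x) → Σℕ≡0⇒≗0 m (u ∘ suc) (ℕₚ.suc-injective (ℕₚ.suc-injective Σu≡2)) x }

SamePair : ∀ {m} → Fin m → Fin m → Fin m → Fin m → Set
SamePair a b p q = ∀ z → (z ≡ a ⊎ z ≡ b → z ≡ p ⊎ z ≡ q) × (z ≡ p ⊎ z ≡ q → z ≡ a ⊎ z ≡ b)

SamePair⇒δ+δ≗ : ∀ {m} {a b p q : Fin m} → SamePair a b p q →
                ∀ x → δ a x ℕ.+ δ b x ≡ δ p x ℕ.+ δ q x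
SamePair⇒δ+δ≗ {a = a} {b} {p} {q} same x
  with proj₁ (same a) (inj₁ refl) | proj₁ (same b) (inj₂ refl)
... | inj₁ refl | inj₂ refl = refl
... | inj₂ refl | inj₁ refl = ℕₚ.+-comm (δ a x) (δ b x)
... | inj₁ refl | inj₁ refl with proj₂ (same q) (inj₂ refl)
...   | inj₁ refl = refl
...   | inj₂ refl = refl
SamePair⇒δ+δ≗ {p = p} same x | inj₂ refl | inj₂ refl with proj₂ (same p) (inj₁ refl)
...   | inj₁ refl = refl
...   | inj₂ refl = refl

infixl 7 _·_

_·_ : ∀ {n m} → Matrix n m → (Fin m → ℤ) → Fin n → ℤ
(A · b) t = Σℤ _ (λ j → A t j ℤ.* b j)

module _ {n m : ℕ} (A : Matrix n m) where

  ·-cong : ∀ {b c} → b ≗ c → A · b ≗ A · c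
  ·-cong b≗c t = Σℤ-cong m (cong (A t _ ℤ.*_) ∘ b≗c)

  ·-zero : A · (λ _ → + 0) ≗ (λ _ → + 0)
  ·-zero t = trans (Σℤ-cong m (ℤₚ.*-zeroʳ ∘ A t)) (Σℤ-zero m)

  ·-distrib-+ : ∀ b c t → (A · (λ j → b j + c j)) t ≡ (A · b) t + (A · c) t
  ·-distrib-+ b c t =
    trans (Σℤ-cong m (λ j → ℤₚ.*-distribˡ-+ (A t j) (b j) (c j))) (Σℤ-distrib-+ m _ _)

  ·-neg : ∀ c t → (A · (ℤ.-_ ∘ c)) t ≡ ℤ.- (A · c) t
  ·-neg c t = trans (Σℤ-cong m (λ j → sym (ℤₚ.neg-distribʳ-* (A t j) (c j)))) (Σℤ-neg m _)

  ·-distrib-- : ∀ b c t → (A · (λ j → b j ℤ.- c j)) t ≡ (A · b) t ℤ.- (A · c) t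
  ·-distrib-- b c t = trans (·-distrib-+ b (ℤ.-_ ∘ c) t) (cong (_+_ ((A · b) t)) (·-neg c t))

  ·-δ : ∀ p t → (A · (λ j → + δ p j)) t ≡ A t p
  ·-δ p t = Σℤ-*-δ m (A t) p

  -- ·-distrib-+ applies to sums of naturals since + (a ℕ.+ b) reduces to + a + + b.
  ·-δ+δ : ∀ {u} p q → u ≗ (λ x → δ p x ℕ.+ δ q x) → ∀ t → (A · (+_ ∘ u)) t ≡ A t p + A t q
  ·-δ+δ p q u≗δ+δ t = trans (·-cong (cong +_ ∘ u≗δ+δ) t)
    (trans (·-distrib-+ (λ x → + δ p x) (λ x → + δ q x) t) (cong₂ _+_ (·-δ p t) (·-δ q t)))

  ·-count : ∀ {r} (f : Fin r → Fin m) t → (A · (λ x → + count f x)) t ≡ Σℤ r (λ k → A t (f k))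
  ·-count {zero}  f t = ·-zero t
  ·-count {suc r} f t =
    trans (·-distrib-+ (λ x → + δ (f zero) x) (λ x → + count (f ∘ suc) x) t)
          (cong₂ _+_ (·-δ (f zero) t) (·-count (f ∘ suc) t))

module Weights {c ℓ : Level} (K : Field c ℓ) (m : ℕ) where
  open Field K renaming ( _+_ to _⊕_; _*_ to _⊗_; _-_ to _⊝_
                        ; refl to ≈-refl; sym to ≈-sym; trans to ≈-trans; reflexive to ≈-reflexive)
  open Poly K m
  open RingProperties ring using (-1*x≈-x)
  open SetoidReasoning setoid

  _≟ₘ_ : DecidableEquality Monomial
  _≟ₘ_ = ≡-dec ℕ._≟_

  Weight : Set c
  Weight = Monomial → Carrier

  weigh : Weight → Pol → Carrier
  weigh F []            = 0#
  weigh F ((a , w) ∷ f) = a ⊗ F w ⊕ weigh F f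

  shift : Monomial → Weight → Weight
  shift w F v = F (addMono w v)

  weigh-cong : ∀ {F G} → F ≗ G → ∀ f → weigh F f ≡ weigh G f
  weigh-cong F≗G []            = refl
  weigh-cong F≗G ((a , w) ∷ f) = cong₂ (λ x y → a ⊗ x ⊕ y) (F≗G w) (weigh-cong F≗G f)

  weigh-++ : ∀ F f g → weigh F (f ++ g) ≈ weigh F f ⊕ weigh F g
  weigh-++ F []            g = ≈-sym (+-identityˡ _)
  weigh-++ F ((a , w) ∷ f) g = ≈-trans (+-cong ≈-refl (weigh-++ F f g)) (≈-sym (+-assoc _ _ _))

  weigh-binomial : ∀ F u v → weigh F (binomial u v) ≈ F (mono u) ⊝ F (mono v)
  weigh-binomial F u v =
    +-cong (*-identityˡ _) (≈-trans (+-identityʳ _) (-1*x≈-x (F (mono v))))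

  weigh-binomial≈0 : ∀ F u v → F (mono u) ≡ F (mono v) → weigh F (binomial u v) ≈ 0#
  weigh-binomial≈0 F u v Fu≡Fv = ≈-trans (weigh-binomial F u v) (≈-trans
    (+-cong (≈-reflexive Fu≡Fv) ≈-refl) (-‿inverseʳ (F (mono v))))

  weigh-binomial≈1 : ∀ F u v → F (mono u) ≡ 1# → F (mono v) ≡ 0# → weigh F (binomial u v) ≈ 1#
  weigh-binomial≈1 F u v Fu≡1 Fv≡0 rewrite Fu≡1 | Fv≡0 =
    ≈-trans (+-cong (*-identityˡ 1#) (≈-trans (+-identityʳ _) (zeroʳ _))) (+-identityʳ 1#)

  -- φ abstracts the pattern lambda inside _*ₚ_, which cannot be restated up to definitional
  -- equality.
  weigh-map-scale : ∀ F a w (φ : Carrier × Monomial → Carrier × Monomial) →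
                    (∀ b v → φ (b , v) ≡ (a ⊗ b , addMono w v)) →
                    ∀ g → weigh F (map φ g) ≈ a ⊗ weigh (shift w F) g
  weigh-map-scale F a w φ φ≡ []            = ≈-sym (zeroʳ a)
  weigh-map-scale F a w φ φ≡ ((b , v) ∷ g) rewrite φ≡ b v = begin
    (a ⊗ b) ⊗ F (addMono w v) ⊕ weigh F (map φ g)
      ≈⟨ +-cong (*-assoc a b _) (weigh-map-scale F a w φ φ≡ g) ⟩
    a ⊗ (b ⊗ F (addMono w v)) ⊕ a ⊗ weigh (shift w F) g
      ≈⟨ ≈-sym (distribˡ a _ _) ⟩
    a ⊗ weigh (shift w F) ((b , v) ∷ g) ∎

  weigh-*ₚ-∷ : ∀ F a w h g →
               weigh F (((a , w) ∷ h) *ₚ g) ≈ a ⊗ weigh (shift w F) g ⊕ weigh F (h *ₚ g)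
  weigh-*ₚ-∷ F a w h g = begin
    weigh F (map _ g ++ (h *ₚ g))
      ≈⟨ weigh-++ F (map _ g) (h *ₚ g) ⟩
    weigh F (map _ g) ⊕ weigh F (h *ₚ g)
      ≈⟨ +-cong (weigh-map-scale F a w _ (λ _ _ → refl) g) ≈-refl ⟩
    a ⊗ weigh (shift w F) g ⊕ weigh F (h *ₚ g) ∎

  Annihilates : Weight → Pol → Set ℓ
  Annihilates F g = ∀ w → weigh (shift w F) g ≈ 0#

  weigh-*ₚ-annihilated : ∀ {F g} h → Annihilates F g → weigh F (h *ₚ g) ≈ 0#
  weigh-*ₚ-annihilated             []            ann = ≈-refl
  weigh-*ₚ-annihilated {F} {g} ((a , w) ∷ h) ann = begin
    weigh F (((a , w) ∷ h) *ₚ g)              ≈⟨ weigh-*ₚ-∷ F a w h g ⟩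
    a ⊗ weigh (shift w F) g ⊕ weigh F (h *ₚ g) ≈⟨ +-cong (*-cong ≈-refl (ann w))
                                                         (weigh-*ₚ-annihilated h ann) ⟩
    a ⊗ 0# ⊕ 0#                                ≈⟨ ≈-trans (+-identityʳ _) (zeroʳ a) ⟩
    0#                                         ∎

  weigh-combination : ∀ {F} L → All (Annihilates F ∘ proj₂) L → weigh F (combination L) ≈ 0#
  weigh-combination {F} []            []           = ≈-refl
  weigh-combination {F} ((h , g) ∷ L) (ann ∷ anns) =
    ≈-trans (weigh-++ F (h *ₚ g) (combination L))
          (≈-trans (+-cong (weigh-*ₚ-annihilated h ann) (weigh-combination L anns)) (+-identityʳ _))

  weighOn : List Monomial → (Monomial → Carrier) → Weight → Carrier
  weighOn []      κ F = 0#
  weighOn (s ∷ S) κ F = κ s ⊗ F s ⊕ weighOn S κ F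

  weighOn-cong : ∀ S {κ μ} F → (∀ s → κ s ≈ μ s) → weighOn S κ F ≈ weighOn S μ F
  weighOn-cong []      F κ≈μ = ≈-refl
  weighOn-cong (s ∷ S) F κ≈μ = +-cong (*-cong (κ≈μ s) ≈-refl) (weighOn-cong S F κ≈μ)

  weighOn-+ : ∀ S κ μ F → weighOn S (λ s → κ s ⊕ μ s) F ≈ weighOn S κ F ⊕ weighOn S μ F
  weighOn-+ []      κ μ F = ≈-sym (+-identityʳ _)
  weighOn-+ (s ∷ S) κ μ F = begin
    (κ s ⊕ μ s) ⊗ F s ⊕ weighOn S (λ s → κ s ⊕ μ s) F
      ≈⟨ +-cong (distribʳ _ _ _) (weighOn-+ S κ μ F) ⟩
    (κ s ⊗ F s ⊕ μ s ⊗ F s) ⊕ (weighOn S κ F ⊕ weighOn S μ F)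
      ≈⟨ interchange +-commutativeSemigroup _ _ _ _ ⟩
    (κ s ⊗ F s ⊕ weighOn S κ F) ⊕ (μ s ⊗ F s ⊕ weighOn S μ F) ∎

  weighOn-∉ : ∀ a v S F → All (v ≢_) S → weighOn S (coeff ((a , v) ∷ [])) F ≈ 0#
  weighOn-∉ a v []      F []           = ≈-refl
  weighOn-∉ a v (s ∷ S) F (v≢s ∷ v∉S) with v ≟ₘ s
  ... | yes v≡s = ⊥-elim (v≢s v≡s)
  ... | no  _   = ≈-trans (+-cong (zeroˡ _) (weighOn-∉ a v S F v∉S)) (+-identityʳ _)

  weighOn-∈ : ∀ a v S F → v ∈ S → Unique S → weighOn S (coeff ((a , v) ∷ [])) F ≈ a ⊗ F v
  weighOn-∈ a v (s ∷ S) F (here refl) (v∉S ∷ _) with v ≟ₘ v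
  ... | yes _  =
    ≈-trans (+-cong (*-cong (+-identityʳ a) ≈-refl) (weighOn-∉ a v S F v∉S)) (+-identityʳ _)
  ... | no v≢v = ⊥-elim (v≢v refl)
  weighOn-∈ a v (s ∷ S) F (there v∈S) (s∉S ∷ S!) with v ≟ₘ s
  ... | yes refl = ⊥-elim (All.lookup s∉S v∈S refl)
  ... | no  _    = ≈-trans (+-cong (zeroˡ _) (weighOn-∈ a v S F v∈S S!)) (+-identityˡ _)

  coeff-∷ : ∀ a v f w → coeff ((a , v) ∷ f) w ≈ coeff ((a , v) ∷ []) w ⊕ coeff f w
  coeff-∷ a v f w with v ≟ₘ w
  ... | yes _ = +-cong (≈-sym (+-identityʳ a)) ≈-refl
  ... | no  _ = ≈-sym (+-identityˡ _)

  -- weigh F f depends only on the coefficients of f: collect them over a duplicate-free list S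
  -- containing all monomials of f.
  weigh≈weighOn-coeff : ∀ F S f → Unique S → All (λ t → proj₂ t ∈ S) f →
                        weigh F f ≈ weighOn S (coeff f) F
  weigh≈weighOn-coeff F S [] S! [] = ≈-sym (weighOn-zero S)
    where
    weighOn-zero : ∀ S → weighOn S (λ _ → 0#) F ≈ 0#
    weighOn-zero []      = ≈-refl
    weighOn-zero (s ∷ S) = ≈-trans (+-cong (zeroˡ _) (weighOn-zero S)) (+-identityʳ _)
  weigh≈weighOn-coeff F S ((a , v) ∷ f) S! (v∈S ∷ f⊆S) = begin
    a ⊗ F v ⊕ weigh F f
      ≈⟨ +-cong (≈-sym (weighOn-∈ a v S F v∈S S!)) (weigh≈weighOn-coeff F S f S! f⊆S) ⟩
    weighOn S (coeff ((a , v) ∷ [])) F ⊕ weighOn S (coeff f) F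
      ≈⟨ ≈-sym (weighOn-+ S _ _ F) ⟩
    weighOn S (λ w → coeff ((a , v) ∷ []) w ⊕ coeff f w) F
      ≈⟨ weighOn-cong S F (λ w → ≈-sym (coeff-∷ a v f w)) ⟩
    weighOn S (coeff ((a , v) ∷ f)) F ∎

  monomials : Pol → List Monomial
  monomials f = deduplicate _≟ₘ_ (map proj₂ f)

  monomials-complete : ∀ f → All (λ t → proj₂ t ∈ monomials f) f
  monomials-complete f = All.tabulate (∈-deduplicate⁺ _≟ₘ_ ∘ ∈-map⁺ proj₂)

  weigh-resp-≈ₚ : ∀ F f g → f ≈ₚ g → weigh F f ≈ weigh F g
  weigh-resp-≈ₚ F f g f≈g = begin
    weigh F f              ≈⟨ weigh≈weighOn-coeff F S f S! (Allₚ.++⁻ˡ f complete) ⟩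
    weighOn S (coeff f) F  ≈⟨ weighOn-cong S F f≈g ⟩
    weighOn S (coeff g) F  ≈⟨ ≈-sym (weigh≈weighOn-coeff F S g S! (Allₚ.++⁻ʳ f complete)) ⟩
    weigh F g              ∎
    where
    S = monomials (f ++ g)
    S! = deduplicate-! _≟ₘ_ (map proj₂ (f ++ g))
    complete = monomials-complete (f ++ g)

  indicator : ∀ {p} {P : Pred Monomial p} → Decidable P → Weight
  indicator P? w = if does (P? w) then 1# else 0#

  module _ {p} {P : Pred Monomial p} (P? : Decidable P) where

    indicator-∈ : ∀ w → P w → indicator P? w ≡ 1#
    indicator-∈ w Pw rewrite dec-true (P? w) Pw = refl

    indicator-∉ : ∀ w → ¬ P w → indicator P? w ≡ 0#
    indicator-∉ w ¬Pw rewrite dec-false (P? w) ¬Pw = refl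

    indicator-cong : ∀ v w → P v ⇔ P w → indicator P? v ≡ indicator P? w
    indicator-cong v w Pv⇔Pw with P? w
    ... | yes Pw = indicator-∈ v (Equivalence.from Pv⇔Pw Pw)
    ... | no ¬Pw = indicator-∉ v (¬Pw ∘ Equivalence.to Pv⇔Pw)

  point : Monomial → Weight
  point u = indicator (_≟ₘ u)

  coeff≈weigh-point : ∀ f u → coeff f u ≈ weigh (point u) f
  coeff≈weigh-point []            u = ≈-refl
  coeff≈weigh-point ((a , v) ∷ f) u with v ≟ₘ u
  ... | yes _ = +-cong (≈-sym (*-identityʳ a)) (coeff≈weigh-point f u)
  ... | no  _ = ≈-trans (≈-sym (+-identityˡ _)) (+-cong (≈-sym (zeroʳ a)) (coeff≈weigh-point f u))

  asCombination : Pol → List (Pol × Pol)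
  asCombination g = ((1# , replicate m 0) ∷ [] , g) ∷ []

  weigh-asCombination : ∀ F g → weigh F (combination (asCombination g)) ≈ weigh F g
  weigh-asCombination F g = begin
    weigh F ((((1# , replicate m 0) ∷ []) *ₚ g) ++ [])
      ≈⟨ ≈-trans (weigh-++ F (((1# , replicate m 0) ∷ []) *ₚ g) []) (+-identityʳ _) ⟩
    weigh F (((1# , replicate m 0) ∷ []) *ₚ g)
      ≈⟨ ≈-trans (weigh-*ₚ-∷ F 1# (replicate m 0) [] g) (+-identityʳ _) ⟩
    1# ⊗ weigh (shift (replicate m 0) F) g
      ≈⟨ *-identityˡ _ ⟩
    weigh (shift (replicate m 0) F) g
      ≡⟨ weigh-cong (cong F ∘ zipWith-identityˡ ℕₚ.+-identityˡ) g ⟩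
    weigh F g ∎

  generator-∈-ideal : ∀ {ℓ′} (G : Pred Pol ℓ′) {g} → G g → InIdeal G g
  generator-∈-ideal G {g} Gg = asCombination g , Gg ∷ [] , λ u → begin
    coeff g u                     ≈⟨ coeff≈weigh-point g u ⟩
    weigh (point u) g             ≈⟨ weigh-asCombination (point u) g ⟨
    weigh (point u) (combination (asCombination g))
                                  ≈⟨ coeff≈weigh-point (combination (asCombination g)) u ⟨
    coeff (combination (asCombination g)) u ∎

  InIdeal-resp-≈ₚ : ∀ {ℓ′} {G : Pred Pol ℓ′} f g → f ≈ₚ g → InIdeal G f → InIdeal G g
  InIdeal-resp-≈ₚ f g f≈g (L , gens , f≈L) = L , gens , λ u → ≈-trans (≈-sym (f≈g u)) (f≈L u)

  Annihilates-resp-≈ₚ : ∀ F f g → f ≈ₚ g → Annihilates F g → Annihilates F f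
  Annihilates-resp-≈ₚ F f g f≈g ann w = ≈-trans (weigh-resp-≈ₚ (shift w F) f g f≈g) (ann w)

  weigh-ideal : ∀ {ℓ′} {G : Pred Pol ℓ′} F f → (∀ {g} → G g → Annihilates F g) →
                InIdeal G f → weigh F f ≈ 0#
  weigh-ideal F f ann (L , gens , f≈L) =
    ≈-trans (weigh-resp-≈ₚ F f (combination L) f≈L) (weigh-combination L (All.map ann gens))

module Toric {c ℓ : Level} (K : Field c ℓ) {n m : ℕ} (A : Matrix n m) where
  open Field K using (setoid; 1#; 0#; 1≉0)
  open Poly K m
  open Weights K m

  A-degree : Monomial → Fin n → ℤ
  A-degree w = A · (λ j → + lookup w j)

  A-degree-mono : ∀ u → A-degree (mono u) ≗ A · (+_ ∘ u)
  A-degree-mono u = ·-cong A (cong +_ ∘ lookup∘tabulate u)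

  A-degree-addMono : ∀ w v t → A-degree (addMono w v) t ≡ A-degree w t + A-degree v t
  A-degree-addMono w v t =
    trans (·-cong A (λ j → cong +_ (lookup-zipWith ℕ._+_ j w v)) t) (·-distrib-+ A _ _ t)

  A-degree-kernel : ∀ b → InKernel A b → A-degree (mono (pos ∘ b)) ≗ A-degree (mono (neg ∘ b))
  A-degree-kernel b Ab≡0 t = begin
    A-degree (mono (pos ∘ b)) t  ≡⟨ A-degree-mono (pos ∘ b) t ⟩
    (A · (+_ ∘ pos ∘ b)) t       ≡⟨ ℤₚ.i-j≡0⇒i≡j _ _ (begin
      (A · (+_ ∘ pos ∘ b)) t ℤ.- (A · (+_ ∘ neg ∘ b)) t  ≡⟨ ·-distrib-- A _ _ t ⟨
      (A · (λ j → + pos (b j) ℤ.- + neg (b j))) t       ≡⟨ ·-cong A (sym ∘ pos-neg ∘ b) t ⟩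
      (A · b) t                                         ≡⟨ Ab≡0 t ⟩
      + 0                                               ∎) ⟩
    (A · (+_ ∘ neg ∘ b)) t       ≡⟨ A-degree-mono (neg ∘ b) t ⟨
    A-degree (mono (neg ∘ b)) t  ∎
    where
    open ≡-Reasoning
    pos-neg : ∀ z → z ≡ + pos z ℤ.- + neg z
    pos-neg (+ k)    = sym (ℤₚ.+-identityʳ (+ k))
    pos-neg -[1+ k ] = refl

  A-degree≗? : ∀ d → Decidable (λ w → A-degree w ≗ d)
  A-degree≗? d w = all? (λ t → A-degree w t ℤ.≟ d t)

  fiber : (Fin n → ℤ) → Weight
  fiber d = indicator (A-degree≗? d)

  fiber-annihilates-generator : ∀ d {g} → ToricGenerator A g → Annihilates (fiber d) g
  fiber-annihilates-generator d (b , Ab≡0 , refl) w =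
    weigh-binomial≈0 (shift w (fiber d)) (pos ∘ b) (neg ∘ b)
      (indicator-cong (A-degree≗? d) (addMono w b⁺) (addMono w b⁻) (mk⇔
        (λ w+b⁺≗d t → trans (sym (same-degree t)) (w+b⁺≗d t))
        (λ w+b⁻≗d t → trans (same-degree t) (w+b⁻≗d t))))
    where
    b⁺ = mono (pos ∘ b)
    b⁻ = mono (neg ∘ b)
    same-degree : A-degree (addMono w b⁺) ≗ A-degree (addMono w b⁻)
    same-degree t = begin
      A-degree (addMono w b⁺) t     ≡⟨ A-degree-addMono w b⁺ t ⟩
      A-degree w t + A-degree b⁺ t  ≡⟨ cong (_+_ (A-degree w t)) (A-degree-kernel b Ab≡0 t) ⟩
      A-degree w t + A-degree b⁻ t  ≡⟨ A-degree-addMono w b⁻ t ⟨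
      A-degree (addMono w b⁻) t     ∎
      where open ≡-Reasoning

  binomial-homogeneous : ∀ u v → InToricIdeal A (binomial u v) →
                         A-degree (mono u) ≗ A-degree (mono v)
  binomial-homogeneous u v uv∈I with A-degree≗? (A-degree (mono u)) (mono v)
  ... | yes v≗u = sym ∘ v≗u
  ... | no  v≉u = ⊥-elim (1≉0 (begin
    1#                      ≈⟨ weigh-binomial≈1 F u v
                                 (indicator-∈ (A-degree≗? d) (mono u) (λ _ → refl))
                                 (indicator-∉ (A-degree≗? d) (mono v) v≉u) ⟨
    weigh F (binomial u v)  ≈⟨ weigh-ideal F (binomial u v) (fiber-annihilates-generator d) uv∈I ⟩
    0#                      ∎))
    where
    open SetoidReasoning setoid
    d = A-degree (mono u)
    F = fiber d

  IsolatedQuadraticDivisors : Monomial → Set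
  IsolatedQuadraticDivisors u₀ = ∀ w u v → deg u ≡ 2 → deg v ≡ 2 → addMono w (mono u) ≡ u₀ →
                                 A-degree (mono u) ≗ A-degree (mono v) → mono u ≡ mono v

  point-annihilates-quadratic : ∀ {u₀} → IsolatedQuadraticDivisors u₀ →
                                ∀ u v → deg u ≡ 2 → deg v ≡ 2 →
                                A-degree (mono u) ≗ A-degree (mono v) →
                                Annihilates (point u₀) (binomial u v)
  point-annihilates-quadratic {u₀} isolated u v deg-u deg-v u≗v w =
    weigh-binomial≈0 (shift w (point u₀)) u v (indicator-cong (_≟ₘ u₀) _ _ (mk⇔
      (exchange u v deg-u deg-v u≗v) (exchange v u deg-v deg-u (sym ∘ u≗v))))
    where
    exchange : ∀ u v → deg u ≡ 2 → deg v ≡ 2 → A-degree (mono u) ≗ A-degree (mono v) →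
               addMono w (mono u) ≡ u₀ → addMono w (mono v) ≡ u₀
    exchange u v deg-u deg-v u≗v wu≡u₀ =
      subst (λ y → addMono w y ≡ u₀) (isolated w u v deg-u deg-v wu≡u₀ u≗v) wu≡u₀

  ¬generated-if-isolated : ∀ b → InKernel A b → mono (pos ∘ b) ≢ mono (neg ∘ b) →
                           IsolatedQuadraticDivisors (mono (pos ∘ b)) →
                           ¬ GeneratedByQuadraticBinomials A
  ¬generated-if-isolated b Ab≡0 b⁺≢b⁻ isolated (G , quadratic , G≡I) = 1≉0 (begin
    1#         ≈⟨ weigh-binomial≈1 F (pos ∘ b) (neg ∘ b) (indicator-∈ (_≟ₘ b⁺) b⁺ refl)
                                   (indicator-∉ (_≟ₘ b⁺) (mono (neg ∘ b)) (b⁺≢b⁻ ∘ sym)) ⟨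
    weigh F T  ≈⟨ weigh-ideal F T annihilated (proj₁ (G≡I T) T∈I) ⟩
    0#         ∎)
    where
    open SetoidReasoning setoid
    b⁺ = mono (pos ∘ b)
    F = point b⁺
    T = binomial (pos ∘ b) (neg ∘ b)
    T∈I : InToricIdeal A T
    T∈I = generator-∈-ideal (ToricGenerator A) (b , Ab≡0 , refl)
    annihilated : ∀ {g} → G g → Annihilates F g
    annihilated {g} Gg with quadratic g Gg
    ... | u , v , deg-u , deg-v , g≈uv =
      Annihilates-resp-≈ₚ F g (binomial u v) g≈uv
        (point-annihilates-quadratic isolated u v deg-u deg-v (binomial-homogeneous u v
          (proj₂ (G≡I (binomial u v))
            (InIdeal-resp-≈ₚ g (binomial u v) g≈uv (generator-∈-ideal G Gg)))))

module MultisetBinomial {c ℓ : Level} (K : Field c ℓ) {n m : ℕ} (A : Matrix n m)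
                        {r : ℕ} (i j : Fin r → Fin m) where
  open Poly K m
  open Toric K A
  open ≡-Reasoning

  b : Fin m → ℤ
  b x = + count i x ℤ.- + count j x

  b-kernel : (∀ t → Σℤ r (λ k → A t (i k)) ≡ Σℤ r (λ k → A t (j k))) → InKernel A b
  b-kernel Σi≡Σj t = begin
    (A · b) t
      ≡⟨ ·-distrib-- A _ _ t ⟩
    (A · (+_ ∘ count i)) t ℤ.- (A · (+_ ∘ count j)) t
      ≡⟨ cong₂ ℤ._-_ (·-count A i t) (·-count A j t) ⟩
    Σℤ r (λ k → A t (i k)) ℤ.- Σℤ r (λ k → A t (j k))
      ≡⟨ ℤₚ.i≡j⇒i-j≡0 (Σi≡Σj t) ⟩
    + 0 ∎

  addMono-≡⇒≤ : ∀ w u v → addMono w (mono u) ≡ mono v → ∀ x → u x ≤ v x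
  addMono-≡⇒≤ w u v wu≡v x = subst (u x ≤_) (begin
    lookup w x ℕ.+ u x                ≡⟨ cong (ℕ._+_ (lookup w x)) (lookup∘tabulate u x) ⟨
    lookup w x ℕ.+ lookup (mono u) x  ≡⟨ lookup-zipWith ℕ._+_ x w (mono u) ⟨
    lookup (addMono w (mono u)) x     ≡⟨ cong (λ y → lookup y x) wu≡v ⟩
    lookup (mono v) x                 ≡⟨ lookup∘tabulate v x ⟩
    v x                               ∎) (ℕₚ.m≤n+m (u x) (lookup w x))

  RigidPairs : Set
  RigidPairs = ∀ k l → k ≢ l → ∀ p q → (∀ t → A t (i k) + A t (i l) ≡ A t p + A t q) →
               ∀ x → δ (i k) x ℕ.+ δ (i l) x ≡ δ p x ℕ.+ δ q x

  rigid-if-unique-sums : (∀ k l → k < l → ∀ p q → (∀ t → A t (i k) + A t (i l) ≡ A t p + A t q) →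
                          SamePair (i k) (i l) p q) →
                         RigidPairs
  rigid-if-unique-sums unique k l k≢l p q sums≡ with <-cmp k l
  ... | tri< k<l _ _ = SamePair⇒δ+δ≗ (unique k l k<l p q sums≡)
  ... | tri≈ _ k≡l _ = ⊥-elim (k≢l k≡l)
  ... | tri> _ _ l<k = λ x → trans (ℕₚ.+-comm (δ (i k) x) (δ (i l) x)) (SamePair⇒δ+δ≗
      (unique l k l<k p q (λ t → trans (ℤₚ.+-comm (A t (i l)) (A t (i k))) (sums≡ t))) x)

  module _ (disjoint : ∀ k l → i k ≢ j l) where

    count-j-i : ∀ k → count j (i k) ≡ 0
    count-j-i k = count-∉ j (i k) (λ l jl≡ik → disjoint k l (sym jl≡ik))

    disjoint-counts : ∀ x → count i x ≡ 0 ⊎ count j x ≡ 0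
    disjoint-counts x with count i x in cᵢ
    ... | zero  = inj₁ refl
    ... | suc _ = let (k , ik≡x) = count-≥1 i x (subst (1 ≤_) (sym cᵢ) (s≤s z≤n)) in
                  inj₂ (subst (λ y → count j y ≡ 0) ik≡x (count-j-i k))

    pos-b : ∀ x → pos (b x) ≡ count i x
    pos-b x with disjoint-counts x
    ... | inj₁ cᵢ≡0 rewrite cᵢ≡0 = pos-0- (count j x)
      where
      pos-0- : ∀ c → pos (+ 0 ℤ.- + c) ≡ 0
      pos-0- zero    = refl
      pos-0- (suc c) = refl
    ... | inj₂ cⱼ≡0 rewrite cⱼ≡0 = ℕₚ.+-identityʳ (count i x)

    neg-b-i : ∀ k → neg (b (i k)) ≡ 0
    neg-b-i k rewrite count-j-i k = refl

    b⁺≢b⁻ : Fin r → mono (pos ∘ b) ≢ mono (neg ∘ b)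
    b⁺≢b⁻ k b⁺≡b⁻ = ℕₚ.<⇒≢ (count-∈ i k) (sym (begin
      count i (i k)                  ≡⟨ pos-b (i k) ⟨
      pos (b (i k))                  ≡⟨ lookup∘tabulate (pos ∘ b) (i k) ⟨
      lookup (mono (pos ∘ b)) (i k)  ≡⟨ cong (λ y → lookup y (i k)) b⁺≡b⁻ ⟩
      lookup (mono (neg ∘ b)) (i k)  ≡⟨ lookup∘tabulate (neg ∘ b) (i k) ⟩
      neg (b (i k))                  ≡⟨ neg-b-i k ⟩
      0                              ∎))

    isolated : RigidPairs → IsolatedQuadraticDivisors (mono (pos ∘ b))
    isolated rigid w u v deg-u deg-v wu≡b⁺ u≗v
      with (p , q , u≗pq) ← Σℕ≡2⇒δ+δ m u deg-u | (p′ , q′ , v≗pq) ← Σℕ≡2⇒δ+δ m v deg-v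
      with (k , l , k≢l , refl , refl) ← δ+δ≤count⇒pair i p q (λ x →
             subst₂ _≤_ (u≗pq x) (pos-b x) (addMono-≡⇒≤ w u (pos ∘ b) wu≡b⁺ x))
      = tabulate-cong λ x → trans (u≗pq x) (trans (rigid k l k≢l p′ q′ sums≡ x) (sym (v≗pq x)))
      where
      sums≡ : ∀ t → A t (i k) + A t (i l) ≡ A t p′ + A t q′
      sums≡ t = begin
        A t (i k) + A t (i l)  ≡⟨ ·-δ+δ A (i k) (i l) u≗pq t ⟨
        (A · (+_ ∘ u)) t       ≡⟨ A-degree-mono u t ⟨
        A-degree (mono u) t    ≡⟨ u≗v t ⟩
        A-degree (mono v) t    ≡⟨ A-degree-mono v t ⟩
        (A · (+_ ∘ v)) t       ≡⟨ ·-δ+δ A p′ q′ v≗pq t ⟩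
        A t p′ + A t q′        ∎

lemma1p1 : ∀ {c ℓ : Level} (K : Field c ℓ) (n m : ℕ) (A : Matrix n m) →
    IsConfiguration A →
    (r : ℕ) → r ≥ 3 →
    (i j : Fin r → Fin m) →
    (∀ t → Σℤ r (λ k → A t (i k)) ≡ Σℤ r (λ k → A t (j k))) →
    (∀ k l → i k ≢ j l) →
    (∀ (k l : Fin r) → k < l → ∀ (p q : Fin m) →
      ((∀ t → A t (i k) + A t (i l) ≡ A t p + A t q) →
         ∀ z → (z ≡ i k ⊎ z ≡ i l → z ≡ p ⊎ z ≡ q) × (z ≡ p ⊎ z ≡ q → z ≡ i k ⊎ z ≡ i l))
      × ((∀ z → (z ≡ i k ⊎ z ≡ i l → z ≡ p ⊎ z ≡ q) × (z ≡ p ⊎ z ≡ q → z ≡ i k ⊎ z ≡ i l)) →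
         ∀ t → A t (i k) + A t (i l) ≡ A t p + A t q)) →
    ¬ Poly.GeneratedByQuadraticBinomials K m A
lemma1p1 K n m A _ (suc r) _ i j Σi≡Σj disjoint unique-sums =
  ¬generated-if-isolated b (b-kernel Σi≡Σj) (b⁺≢b⁻ disjoint zero)
    (isolated disjoint (rigid-if-unique-sums (λ k l k<l p q → proj₁ (unique-sums k l k<l p q))))
  where
  open Toric K A
  open MultisetBinomial K A i j
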